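{- Let $n\ge 0$ be an integer and let $\mathcal P_n$ be the space of complex polynomials of degree at most $n$. Then, as linear operators on $\mathcal P_n$, $$F_n\,U_n^{ -1}=V_n^{ -1}\,C_n\,V_n .$$
   Context: The Euler polynomials $A_k(x)$ are defined by $\frac{A_k(x)}{(1-x)^{k+1}}=\sum_{m\ge0}m^kx^m$, with $A_0=1$ (using $0^0=1$). All operators are linear operators on $\mathcal P_n$ given on monomials $x^p$, $p=0,\dots,n$: $U_n x^p=\frac1{n!}(1-x)^{n-p}A_p(x)=(1-x)^{n+1}\frac1{n!}\sum_{m\ge0}m^px^m$ (invertible; explicitly $U_n^{ -1}x^p=(x)_p[x+1]_{n-p}$, where $(\varphi)_k=\varphi(\varphi-1)\cdots(\varphi-k+1)$, $[\varphi]_k=\varphi(\varphi+1)\cdots(\varphi+k-1)$, both $=1$ for $k=0$); $F_n x^p=(1-x)^{2n+1}\sum_{m\ge0}m^p\binom{m+n}{n}x^m$ (a polynomial of degree $\le n$; $0^0=1$); $V_nx^p=(1+x)^{n-p}x^p$ (so $V_n^{ -1}x^p=(1-x)^{n-p}x^p$); $C_nx^p=\frac{(n+p)!}{p!}x^p$. -}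

module Defs where

open import Data.Nat as ℕ using (ℕ; zero; suc; _∸_; _≡ᵇ_; _!)
open import Data.Nat.DivMod using (_/_)
open import Data.Nat.Properties using (_!≢0)
open import Data.Nat.Combinatorics using (_C_)
open import Data.Bool using (if_then_else_)
open import Data.Integer as ℤ using (ℤ; +_; _+_; _*_; -_)

-- Formal power series (and polynomials) with integer coefficients,
-- represented by their coefficient sequence: s k = coefficient of x^k.
Series : Set
Series = ℕ → ℤ

sumUpTo : ℕ → (ℕ → ℤ) → ℤ
sumUpTo zero    f = f 0
sumUpTo (suc k) f = sumUpTo k f + f (suc k)

_⊛_ : Series → Series → Series
(a ⊛ b) k = sumUpTo k (λ i → a i * b (k ∸ i))

infixl 7 _⊛_

_⊕_ : Series → Series → Series
(a ⊕ b) k = a k + b k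

scale : ℤ → Series → Series
scale c a k = c * a k

mono : ℕ → Series
mono p k = if k ≡ᵇ p then + 1 else + 0

one : Series
one = mono 0

constPlusX : ℤ → Series
constPlusX c = scale c (mono 0) ⊕ mono 1

oneMinusX : Series
oneMinusX = mono 0 ⊕ scale (- (+ 1)) (mono 1)

onePlusX : Series
onePlusX = constPlusX (+ 1)

pow : Series → ℕ → Series
pow a zero    = one
pow a (suc k) = pow a k ⊛ a

falling : ℕ → Series
falling zero    = one
falling (suc k) = falling k ⊛ constPlusX (- (+ k))

rising1 : ℕ → Series
rising1 zero    = one
rising1 (suc k) = rising1 k ⊛ constPlusX (+ suc k)

-- Linear extension to P_n of an operator given on monomials x^0..x^n:
-- applyOn n L f = Σ_{q=0}^{n} f_q · L(x^q)
applyOn : ℕ → (ℕ → Series) → Series → Series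
applyOn n L f k = sumUpTo n (λ q → f q * L q k)

Uinv : ℕ → ℕ → Series
Uinv n p = falling p ⊛ rising1 (n ∸ p)

-- F_n x^p = (1-x)^{2n+1} Σ_{m≥0} m^p binom(m+n,n) x^m   (0^0 = 1)
Fop : ℕ → ℕ → Series
Fop n p = pow oneMinusX (suc (2 ℕ.* n)) ⊛ (λ m → + (m ℕ.^ p ℕ.* ((m ℕ.+ n) C n)))

Vop : ℕ → ℕ → Series
Vop n p = pow onePlusX (n ∸ p) ⊛ mono p

Vinv : ℕ → ℕ → Series
Vinv n p = pow oneMinusX (n ∸ p) ⊛ mono p

Cop : ℕ → ℕ → Series
Cop n p = scale (+ (((n ℕ.+ p) !) / (p !))) (mono p)
  where instance _ = p !≢0

module Submission where

-- Both sides are series (1-x)^{2n+1} · Σ_m c(m) x^m, so it suffices to compare the coefficients c(m).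
--  * Left side: F_n x^q = (1-x)^{2n+1} Σ_m m^q C(m+n,n) x^m, so by linearity c(m) is the value of
--    U_n⁻¹ x^p = (x)_p [x+1]_r at x = m, times C(m+n,n); that is c(m) = (m)_p (m+r)_r C(m+n,n).
--  * Right side: since Σ_m C(m+a,a+s) x^m = x^s / (1-x)^{a+s+1}, we have
--    V_n⁻¹ x^q = (1-x)^{n-q} x^q = (1-x)^{2n+1} Σ_m C(m+n,n+q) x^m.  As C_n V_n x^p = Σ_q C(r,q-p) (n+q)!/q! x^q,
--    c(m) = Σ_q C(r,q-p) (n+q)!/q! C(m+n,n+q) = Σ_q C(r,q-p) C(m,q) (m+n)_n = C(m+r,n) (m+n)_n,
--    the last step being Vandermonde's convolution.
--  * Finally (m)_p (m+r)_r C(m+n,n) = C(m+r,n) (m+n)_n is an identity of falling factorials.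

open import Defs
open import Data.Nat as ℕ using (ℕ; zero; suc; _∸_; _≤_; _<_; z≤n; s≤s; _!)
import Data.Nat.Properties as ℕP
open import Data.Nat.Properties using (_!≢0; _!*_!≢0)
open import Data.Nat.DivMod using (_/_; m/n*n≡m; m*n/n≡m)
open import Data.Nat.Combinatorics
  using (_C_; nCk+nC[k+1]≡[n+1]C[k+1]; nCn≡1; k>n⇒nCk≡0; nCk≡n!/k![n-k]!; k![n∸k]!∣n!)
open import Data.Sum using (inj₁; inj₂)
open import Data.Empty using (⊥-elim)
open import Relation.Nullary using (Dec; yes; no)
open import Relation.Binary.PropositionalEquality
  using (_≡_; _≢_; refl; sym; trans; cong; cong₂; subst; module ≡-Reasoning)

-- Arithmetic of falling factorials and binomial coefficients in ℕ.
module FallingFactorials where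
  open import Data.Nat using (_+_; _*_; _≤?_)
  open import Data.Nat.Tactic.RingSolver using (solve-∀)

  fall : ℕ → ℕ → ℕ
  fall x zero    = 1
  fall x (suc k) = fall x k * (x ∸ k)

  -- (x)_k = 0 once k exceeds x, because the factor x - x = 0 occurs.
  fall-vanishes : ∀ x k → x < k → fall x k ≡ 0
  fall-vanishes x (suc k) (s≤s x≤k) with ℕP.m≤n⇒m<n∨m≡n x≤k
  ... | inj₁ x<k  rewrite fall-vanishes x k x<k = refl
  ... | inj₂ refl rewrite ℕP.n∸n≡0 x = ℕP.*-zeroʳ (fall x x)

  fall-+ : ∀ x i j → fall x (i + j) ≡ fall x i * fall (x ∸ i) j
  fall-+ x i zero rewrite ℕP.+-identityʳ i = sym (ℕP.*-identityʳ (fall x i))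
  fall-+ x i (suc j) rewrite ℕP.+-suc i j | fall-+ x i j | ℕP.∸-+-assoc x i j =
    ℕP.*-assoc (fall x i) (fall (x ∸ i) j) (x ∸ (i + j))

  -- (m+j+1)_{j+1} = (m+j)_j (m+j+1): the recursion of the rising factorial [m+1]_j = (m+j)_j.
  fall-rising : ∀ m j → fall (m + suc j) (suc j) ≡ fall (m + j) j * (m + suc j)
  fall-rising m j = begin
      fall (m + suc j) (1 + j)
    ≡⟨ fall-+ (m + suc j) 1 j ⟩
      (1 * (m + suc j)) * fall (m + suc j ∸ 1) j
    ≡⟨ cong₂ (λ a b → a * fall (b ∸ 1) j) (ℕP.*-identityˡ (m + suc j)) (ℕP.+-suc m j) ⟩
      (m + suc j) * fall (m + j) j
    ≡⟨ ℕP.*-comm (m + suc j) _ ⟩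
      fall (m + j) j * (m + suc j) ∎
    where open ≡-Reasoning

  fall-factorial : ∀ x k → k ≤ x → fall x k * (x ∸ k) ! ≡ x !
  fall-factorial x zero    _    = ℕP.+-identityʳ (x !)
  fall-factorial x (suc k) k<x = begin
      fall x k * (x ∸ k) * (x ∸ suc k) !
    ≡⟨ ℕP.*-assoc (fall x k) (x ∸ k) _ ⟩
      fall x k * ((x ∸ k) * (x ∸ suc k) !)
    ≡⟨ cong (λ d → fall x k * (d * (x ∸ suc k) !)) x∸k≡1+x∸[1+k] ⟩
      fall x k * (suc (x ∸ suc k) !)
    ≡⟨ cong (λ d → fall x k * d !) (sym x∸k≡1+x∸[1+k]) ⟩
      fall x k * (x ∸ k) !
    ≡⟨ fall-factorial x k (ℕP.<⇒≤ k<x) ⟩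
      x ! ∎
    where
      open ≡-Reasoning
      x∸k≡1+x∸[1+k] : x ∸ k ≡ suc (x ∸ suc k)
      x∸k≡1+x∸[1+k] = ℕP.+-∸-assoc 1 k<x

  fall-factorial-+ : ∀ n q → fall (n + q) n * q ! ≡ (n + q) !
  fall-factorial-+ n q =
    trans (cong (λ d → fall (n + q) n * d !) (sym (ℕP.m+n∸m≡n n q))) (fall-factorial (n + q) n (ℕP.m≤m+n n q))

  binomial-factorial : ∀ x k → k ≤ x → (x C k) * (k ! * (x ∸ k) !) ≡ x !
  binomial-factorial x k k≤x =
    trans (cong (_* (k ! * (x ∸ k) !)) (nCk≡n!/k![n-k]! k≤x)) (m/n*n≡m (k![n∸k]!∣n! k≤x))
    where instance _ = k !* (x ∸ k) !≢0

  -- C(x,k) k! = (x)_k for all k (both sides vanish when k > x).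
  binomial-fall : ∀ x k → (x C k) * k ! ≡ fall x k
  binomial-fall x k with k ≤? x
  ... | yes k≤x = ℕP.*-cancelʳ-≡ _ _ ((x ∸ k) !) {{(x ∸ k) !≢0}}
        (trans (ℕP.*-assoc (x C k) (k !) _)
          (trans (binomial-factorial x k k≤x) (sym (fall-factorial x k k≤x))))
  ... | no k≰x rewrite k>n⇒nCk≡0 (ℕP.≰⇒> k≰x) | fall-vanishes x k (ℕP.≰⇒> k≰x) = refl

  -- (n+q)!/q! = (n+q)_n: the eigenvalue of C_n on x^q is a falling factorial.
  factorial-ratio : ∀ n q → ((n + q) ! / q !) {{q !≢0}} ≡ fall (n + q) n
  factorial-ratio n q =
    trans (cong (λ d → (d / q !) {{q !≢0}}) (sym (fall-factorial-+ n q)))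
          (m*n/n≡m (fall (n + q) n) (q !) {{q !≢0}})

  -- (n+q)_n C(m+n,n+q) = C(m,q) (m+n)_n; both sides times q! equal (m+n)_{n+q}.
  fall-binomial-exchange : ∀ m n q → fall (n + q) n * ((m + n) C (n + q)) ≡ (m C q) * fall (m + n) n
  fall-binomial-exchange m n q = ℕP.*-cancelʳ-≡ _ _ (q !) {{q !≢0}} (begin
      fall (n + q) n * ((m + n) C (n + q)) * q !
    ≡⟨ reorder (fall (n + q) n) ((m + n) C (n + q)) (q !) ⟩
      ((m + n) C (n + q)) * (fall (n + q) n * q !)
    ≡⟨ cong (((m + n) C (n + q)) *_) (fall-factorial-+ n q) ⟩
      ((m + n) C (n + q)) * (n + q) !
    ≡⟨ binomial-fall (m + n) (n + q) ⟩
      fall (m + n) (n + q)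
    ≡⟨ fall-+ (m + n) n q ⟩
      fall (m + n) n * fall (m + n ∸ n) q
    ≡⟨ cong (λ d → fall (m + n) n * fall d q) (ℕP.m+n∸n≡m m n) ⟩
      fall (m + n) n * fall m q
    ≡⟨ cong (fall (m + n) n *_) (sym (binomial-fall m q)) ⟩
      fall (m + n) n * ((m C q) * q !)
    ≡⟨ reorder′ (fall (m + n) n) (m C q) (q !) ⟩
      (m C q) * fall (m + n) n * q ! ∎)
    where
      open ≡-Reasoning
      reorder : ∀ a b c → a * b * c ≡ b * (a * c)
      reorder = solve-∀
      reorder′ : ∀ a b c → a * (b * c) ≡ b * a * c
      reorder′ = solve-∀

  -- (m)_p (m+r)_r C(m+p+r,p+r) = C(m+r,p+r) (m+p+r)_{p+r}; both sides times (p+r)! equal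
  -- (m+r)_{p+r} (m+p+r)_{p+r}.
  value-agreement : ∀ m p r →
    fall m p * fall (m + r) r * ((m + (p + r)) C (p + r)) ≡ ((m + r) C (p + r)) * fall (m + (p + r)) (p + r)
  value-agreement m p r = ℕP.*-cancelʳ-≡ _ _ ((p + r) !) {{(p + r) !≢0}} (begin
      fall m p * fall (m + r) r * ((m + (p + r)) C (p + r)) * (p + r) !
    ≡⟨ ℕP.*-assoc (fall m p * fall (m + r) r) _ _ ⟩
      fall m p * fall (m + r) r * (((m + (p + r)) C (p + r)) * (p + r) !)
    ≡⟨ cong (fall m p * fall (m + r) r *_) (binomial-fall (m + (p + r)) (p + r)) ⟩
      fall m p * fall (m + r) r * F
    ≡⟨ cong (_* F) (ℕP.*-comm (fall m p) (fall (m + r) r)) ⟩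
      fall (m + r) r * fall m p * F
    ≡⟨ cong (λ d → fall (m + r) r * fall d p * F) (sym (ℕP.m+n∸n≡m m r)) ⟩
      fall (m + r) r * fall (m + r ∸ r) p * F
    ≡⟨ cong (_* F) (sym (fall-+ (m + r) r p)) ⟩
      fall (m + r) (r + p) * F
    ≡⟨ cong (λ d → fall (m + r) d * F) (ℕP.+-comm r p) ⟩
      fall (m + r) (p + r) * F
    ≡⟨ cong (_* F) (sym (binomial-fall (m + r) (p + r))) ⟩
      ((m + r) C (p + r)) * (p + r) ! * F
    ≡⟨ reorder ((m + r) C (p + r)) ((p + r) !) F ⟩
      ((m + r) C (p + r)) * F * (p + r) ! ∎)
    where
      open ≡-Reasoning
      F : ℕ
      F = fall (m + (p + r)) (p + r)
      reorder : ∀ a b c → a * b * c ≡ a * c * b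
      reorder = solve-∀

open FallingFactorials

open import Data.Integer using (ℤ; +_; _+_; _*_; -_)
import Data.Integer.Properties as ℤP
open import Data.Integer.Tactic.RingSolver using (solve-∀)

-- Finite sums Σ_{i ≤ k} f(i).

sum-cong : ∀ k {f g : ℕ → ℤ} → (∀ i → i ≤ k → f i ≡ g i) → sumUpTo k f ≡ sumUpTo k g
sum-cong zero    h = h 0 z≤n
sum-cong (suc k) h = cong₂ _+_ (sum-cong k (λ i i≤k → h i (ℕP.m≤n⇒m≤1+n i≤k))) (h (suc k) ℕP.≤-refl)

sum-ext : ∀ k {f g : ℕ → ℤ} → (∀ i → f i ≡ g i) → sumUpTo k f ≡ sumUpTo k g
sum-ext k h = sum-cong k (λ i _ → h i)

sum-+ : ∀ k (f g : ℕ → ℤ) → sumUpTo k (λ i → f i + g i) ≡ sumUpTo k f + sumUpTo k g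
sum-+ zero    f g = refl
sum-+ (suc k) f g rewrite sum-+ k f g = interchange (sumUpTo k f) (sumUpTo k g) (f (suc k)) (g (suc k))
  where interchange : ∀ a b c d → a + b + (c + d) ≡ a + c + (b + d)
        interchange = solve-∀

sum-*ˡ : ∀ k (c : ℤ) (f : ℕ → ℤ) → c * sumUpTo k f ≡ sumUpTo k (λ i → c * f i)
sum-*ˡ zero    c f = refl
sum-*ˡ (suc k) c f rewrite sym (sum-*ˡ k c f) = ℤP.*-distribˡ-+ c (sumUpTo k f) (f (suc k))

sum-*ʳ : ∀ k (c : ℤ) (f : ℕ → ℤ) → sumUpTo k f * c ≡ sumUpTo k (λ i → f i * c)
sum-*ʳ k c f =
  trans (ℤP.*-comm (sumUpTo k f) c) (trans (sum-*ˡ k c f) (sum-ext k (λ i → ℤP.*-comm c (f i))))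

sum-zero : ∀ k {f : ℕ → ℤ} → (∀ i → i ≤ k → f i ≡ + 0) → sumUpTo k f ≡ + 0
sum-zero k h = trans (sum-cong k h) (sum-of-zeros k)
  where sum-of-zeros : ∀ k → sumUpTo k (λ _ → + 0) ≡ + 0
        sum-of-zeros zero = refl
        sum-of-zeros (suc k) rewrite sum-of-zeros k = refl

sum-peel : ∀ k (f : ℕ → ℤ) → sumUpTo (suc k) f ≡ f 0 + sumUpTo k (λ i → f (suc i))
sum-peel zero    f = refl
sum-peel (suc k) f rewrite sum-peel k f = ℤP.+-assoc (f 0) _ _

sum-swap : ∀ k N (F : ℕ → ℕ → ℤ) →
  sumUpTo k (λ i → sumUpTo N (λ q → F i q)) ≡ sumUpTo N (λ q → sumUpTo k (λ i → F i q))
sum-swap zero    N F = refl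
sum-swap (suc k) N F rewrite sum-swap k N F =
  sym (sum-+ N (λ q → sumUpTo k (λ i → F i q)) (λ q → F (suc k) q))

sum-reverse : ∀ k (f : ℕ → ℤ) → sumUpTo k f ≡ sumUpTo k (λ i → f (k ∸ i))
sum-reverse zero    f = refl
sum-reverse (suc k) f = begin
    sumUpTo k f + f (suc k)
  ≡⟨ cong (_+ f (suc k)) (sum-reverse k f) ⟩
    sumUpTo k (λ i → f (k ∸ i)) + f (suc k)
  ≡⟨ ℤP.+-comm (sumUpTo k (λ i → f (k ∸ i))) (f (suc k)) ⟩
    f (suc k) + sumUpTo k (λ i → f (suc k ∸ suc i))
  ≡⟨ sym (sum-peel k (λ i → f (suc k ∸ i))) ⟩
    sumUpTo (suc k) (λ i → f (suc k ∸ i)) ∎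
  where open ≡-Reasoning

sum-shift : ∀ p r (g : ℕ → ℤ) → (∀ q → q < p → g q ≡ + 0) → sumUpTo (p ℕ.+ r) g ≡ sumUpTo r (λ j → g (p ℕ.+ j))
sum-shift zero    r g h = refl
sum-shift (suc p) r g h = begin
    sumUpTo (suc (p ℕ.+ r)) g
  ≡⟨ sum-peel (p ℕ.+ r) g ⟩
    g 0 + sumUpTo (p ℕ.+ r) (λ i → g (suc i))
  ≡⟨ cong (_+ sumUpTo (p ℕ.+ r) (λ i → g (suc i))) (h 0 (s≤s z≤n)) ⟩
    + 0 + sumUpTo (p ℕ.+ r) (λ i → g (suc i))
  ≡⟨ ℤP.+-identityˡ _ ⟩
    sumUpTo (p ℕ.+ r) (λ i → g (suc i))
  ≡⟨ sum-shift p r (λ i → g (suc i)) (λ q q<p → h (suc q) (s≤s q<p)) ⟩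
    sumUpTo r (λ j → g (suc (p ℕ.+ j))) ∎
  where open ≡-Reasoning

mono-diag : ∀ p → mono p p ≡ + 1
mono-diag zero    = refl
mono-diag (suc p) = mono-diag p

mono-off : ∀ p i → i ≢ p → mono p i ≡ + 0
mono-off zero    zero    i≢p = ⊥-elim (i≢p refl)
mono-off zero    (suc i) i≢p = refl
mono-off (suc p) zero    i≢p = refl
mono-off (suc p) (suc i) i≢p = mono-off p i (λ i≡p → i≢p (cong suc i≡p))

mono-sym : ∀ a b → mono a b ≡ mono b a
mono-sym zero    zero    = refl
mono-sym zero    (suc b) = refl
mono-sym (suc a) zero    = refl
mono-sym (suc a) (suc b) = mono-sym a b

sift-≤ : ∀ k p (g : ℕ → ℤ) → p ≤ k → sumUpTo k (λ i → mono p i * g i) ≡ g p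
sift-> : ∀ k p (g : ℕ → ℤ) → k < p → sumUpTo k (λ i → mono p i * g i) ≡ + 0
sift-> zero    (suc p) g k<p = ℤP.*-zeroˡ (g 0)
sift-> (suc k) p       g k<p
  rewrite sift-> k p g (ℕP.<-trans ℕP.≤-refl k<p) | mono-off p (suc k) (λ e → ℕP.<-irrefl e k<p) =
  ℤP.*-zeroˡ (g (suc k))
sift-≤ zero    zero g _ = ℤP.*-identityˡ (g 0)
sift-≤ (suc k) p    g p≤k with ℕP.m≤n⇒m<n∨m≡n p≤k
... | inj₁ p<k rewrite sift-≤ k p g (ℕP.≤-pred p<k)
    | mono-off p (suc k) (λ e → ℕP.<-irrefl (sym e) p<k) | ℤP.*-zeroˡ (g (suc k)) = ℤP.+-identityʳ (g p)
... | inj₂ refl rewrite sift-> k (suc k) g ℕP.≤-refl | mono-diag (suc k) =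
  trans (ℤP.+-identityˡ (+ 1 * g (suc k))) (ℤP.*-identityˡ (g (suc k)))

-- The ring of coefficient sequences under the Cauchy product.

infix 4 _≈_
_≈_ : Series → Series → Set
a ≈ b = ∀ k → a k ≡ b k

⊛-congˡ : ∀ {a a′} b → a ≈ a′ → a ⊛ b ≈ a′ ⊛ b
⊛-congˡ b h k = sum-ext k (λ i → cong (_* b (k ∸ i)) (h i))

⊛-congʳ : ∀ a {b b′} → b ≈ b′ → a ⊛ b ≈ a ⊛ b′
⊛-congʳ a h k = sum-ext k (λ i → cong (a i *_) (h (k ∸ i)))

⊛-comm : ∀ a b → a ⊛ b ≈ b ⊛ a
⊛-comm a b k = trans (sum-reverse k _) (sum-cong k (λ i i≤k →
  trans (cong (a (k ∸ i) *_) (cong b (ℕP.m∸[m∸n]≡n i≤k))) (ℤP.*-comm (a (k ∸ i)) (b i))))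

affine-distrib : ∀ s x y z → (s * x + y) * z ≡ s * (x * z) + y * z
affine-distrib = solve-∀

⊛-linearˡ : ∀ (s : ℤ) f g c k → ((λ i → s * f i + g i) ⊛ c) k ≡ s * (f ⊛ c) k + (g ⊛ c) k
⊛-linearˡ s f g c k = begin
    sumUpTo k (λ i → (s * f i + g i) * c (k ∸ i))
  ≡⟨ sum-ext k (λ i → affine-distrib s (f i) (g i) (c (k ∸ i))) ⟩
    sumUpTo k (λ i → s * (f i * c (k ∸ i)) + g i * c (k ∸ i))
  ≡⟨ sum-+ k _ _ ⟩
    sumUpTo k (λ i → s * (f i * c (k ∸ i))) + (g ⊛ c) k
  ≡⟨ cong (_+ (g ⊛ c) k) (sym (sum-*ˡ k s _)) ⟩
    s * (f ⊛ c) k + (g ⊛ c) k ∎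
  where open ≡-Reasoning

shift : Series → Series
shift a i = a (suc i)

⊛-suc : ∀ a b k → (a ⊛ b) (suc k) ≡ a 0 * b (suc k) + (shift a ⊛ b) k
⊛-suc a b k = sum-peel k (λ i → a i * b (suc k ∸ i))

⊛-assoc : ∀ a b c → (a ⊛ b) ⊛ c ≈ a ⊛ (b ⊛ c)
⊛-assoc a b c zero    = ℤP.*-assoc (a 0) (b 0) (c 0)
⊛-assoc a b c (suc k) = begin
    ((a ⊛ b) ⊛ c) (suc k)
  ≡⟨ ⊛-suc (a ⊛ b) c k ⟩
    (a 0 * b 0) * c (suc k) + (shift (a ⊛ b) ⊛ c) k
  ≡⟨ cong (_+_ head) (⊛-congˡ c (⊛-suc a b) k) ⟩
    head + ((λ i → a 0 * shift b i + (shift a ⊛ b) i) ⊛ c) k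
  ≡⟨ cong (_+_ head) (⊛-linearˡ (a 0) (shift b) (shift a ⊛ b) c k) ⟩
    head + (a 0 * (shift b ⊛ c) k + ((shift a ⊛ b) ⊛ c) k)
  ≡⟨ cong (λ z → head + (a 0 * (shift b ⊛ c) k + z)) (⊛-assoc (shift a) b c k) ⟩
    head + (a 0 * (shift b ⊛ c) k + (shift a ⊛ (b ⊛ c)) k)
  ≡⟨ regroup (a 0) (b 0) (c (suc k)) ((shift b ⊛ c) k) ((shift a ⊛ (b ⊛ c)) k) ⟩
    a 0 * (b 0 * c (suc k) + (shift b ⊛ c) k) + (shift a ⊛ (b ⊛ c)) k
  ≡⟨ cong (λ z → a 0 * z + (shift a ⊛ (b ⊛ c)) k) (sym (⊛-suc b c k)) ⟩
    a 0 * (b ⊛ c) (suc k) + (shift a ⊛ (b ⊛ c)) k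
  ≡⟨ sym (⊛-suc a (b ⊛ c) k) ⟩
    (a ⊛ (b ⊛ c)) (suc k) ∎
  where open ≡-Reasoning
        head : ℤ
        head = (a 0 * b 0) * c (suc k)
        regroup : ∀ x y z u v → (x * y) * z + (x * u + v) ≡ x * (y * z + u) + v
        regroup = solve-∀

one-⊛ : ∀ a → one ⊛ a ≈ a
one-⊛ a k = sift-≤ k 0 (λ i → a (k ∸ i)) z≤n

⊛-one : ∀ a → a ⊛ one ≈ a
⊛-one a k = trans (⊛-comm a one k) (one-⊛ a k)

⊛-mono-≥ : ∀ a p k → p ≤ k → (a ⊛ mono p) k ≡ a (k ∸ p)
⊛-mono-≥ a p k p≤k = trans (⊛-comm a (mono p) k) (sift-≤ k p (λ i → a (k ∸ i)) p≤k)

⊛-mono-< : ∀ a p k → k < p → (a ⊛ mono p) k ≡ + 0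
⊛-mono-< a p k k<p = trans (⊛-comm a (mono p) k) (sift-> k p (λ i → a (k ∸ i)) k<p)

pow-+ : ∀ a i j → pow a (i ℕ.+ j) ≈ pow a i ⊛ pow a j
pow-+ a zero    j k = sym (one-⊛ (pow a j) k)
pow-+ a (suc i) j k = begin
    (pow a (i ℕ.+ j) ⊛ a) k
  ≡⟨ ⊛-congˡ a (pow-+ a i j) k ⟩
    ((pow a i ⊛ pow a j) ⊛ a) k
  ≡⟨ ⊛-assoc (pow a i) (pow a j) a k ⟩
    (pow a i ⊛ (pow a j ⊛ a)) k
  ≡⟨ ⊛-congʳ (pow a i) (⊛-comm (pow a j) a) k ⟩
    (pow a i ⊛ (a ⊛ pow a j)) k
  ≡⟨ sym (⊛-assoc (pow a i) a (pow a j) k) ⟩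
    ((pow a i ⊛ a) ⊛ pow a j) k ∎
  where open ≡-Reasoning

module LinearFactor (L : Series) (α β : ℤ)
                    (L₀ : L 0 ≡ α) (L₁ : L 1 ≡ β) (L₂₊ : ∀ i → L (suc (suc i)) ≡ + 0) where

  at-zero : ∀ a → (L ⊛ a) 0 ≡ α * a 0
  at-zero a = cong (_* a 0) L₀

  at-suc : ∀ a k → (L ⊛ a) (suc k) ≡ α * a (suc k) + β * a k
  at-suc a zero    = cong₂ _+_ (cong (_* a 1) L₀) (cong (_* a 0) L₁)
  at-suc a (suc k) = begin
      (L ⊛ a) (suc (suc k))
    ≡⟨ ⊛-suc L a (suc k) ⟩
      L 0 * a (suc (suc k)) + (shift L ⊛ a) (suc k)
    ≡⟨ cong (_+_ (L 0 * a (suc (suc k)))) (⊛-suc (shift L) a k) ⟩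
      L 0 * a (suc (suc k)) + (L 1 * a (suc k) + (shift (shift L) ⊛ a) k)
    ≡⟨ cong (λ z → L 0 * a (suc (suc k)) + (L 1 * a (suc k) + z))
         (sum-zero k (λ i _ → trans (cong (_* a (k ∸ i)) (L₂₊ i)) (ℤP.*-zeroˡ (a (k ∸ i))))) ⟩
      L 0 * a (suc (suc k)) + (L 1 * a (suc k) + + 0)
    ≡⟨ cong₂ (λ x y → x * a (suc (suc k)) + y) L₀ (trans (ℤP.+-identityʳ _) (cong (_* a (suc k)) L₁)) ⟩
      α * a (suc (suc k)) + β * a (suc k) ∎
    where open ≡-Reasoning

module OneMinusX = LinearFactor oneMinusX (+ 1) (- + 1) refl refl (λ _ → refl)
module X         = LinearFactor (mono 1) (+ 0) (+ 1) refl refl (λ _ → refl)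
module CPlusX (c : ℤ) = LinearFactor (constPlusX c) c (+ 1)
  (trans (ℤP.+-identityʳ (c * + 1)) (ℤP.*-identityʳ c))
  (cong (_+ + 1) (ℤP.*-zeroʳ c))
  (λ i → trans (ℤP.+-identityʳ (c * + 0)) (ℤP.*-zeroʳ c))

x⊛-zero : ∀ a → (mono 1 ⊛ a) 0 ≡ + 0
x⊛-zero a = X.at-zero a

x⊛-suc : ∀ a k → (mono 1 ⊛ a) (suc k) ≡ a k
x⊛-suc a k = trans (X.at-suc a k) (simplify (a (suc k)) (a k))
  where simplify : ∀ u v → + 0 * u + + 1 * v ≡ v
        simplify = solve-∀

-- Generating functions of binomial coefficients.

pascal : ∀ n k → + (n C k) + + (n C suc k) ≡ + (suc n C suc k)
pascal n k = trans (sym (ℤP.pos-+ (n C k) (n C suc k))) (cong +_ (nCk+nC[k+1]≡[n+1]C[k+1] n k))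

binomial-theorem : ∀ r j → pow onePlusX r j ≡ + (r C j)
binomial-theorem zero    zero    = refl
binomial-theorem zero    (suc j) = refl
binomial-theorem (suc r) zero    = begin
    (pow onePlusX r ⊛ onePlusX) 0
  ≡⟨ ⊛-comm (pow onePlusX r) onePlusX 0 ⟩
    (onePlusX ⊛ pow onePlusX r) 0
  ≡⟨ CPlusX.at-zero (+ 1) (pow onePlusX r) ⟩
    + 1 * pow onePlusX r 0
  ≡⟨ trans (ℤP.*-identityˡ _) (binomial-theorem r 0) ⟩
    + 1 ∎
  where open ≡-Reasoning
binomial-theorem (suc r) (suc j) = begin
    (pow onePlusX r ⊛ onePlusX) (suc j)
  ≡⟨ ⊛-comm (pow onePlusX r) onePlusX (suc j) ⟩
    (onePlusX ⊛ pow onePlusX r) (suc j)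
  ≡⟨ CPlusX.at-suc (+ 1) (pow onePlusX r) j ⟩
    + 1 * pow onePlusX r (suc j) + + 1 * pow onePlusX r j
  ≡⟨ cong₂ (λ u v → + 1 * u + + 1 * v) (binomial-theorem r (suc j)) (binomial-theorem r j) ⟩
    + 1 * + (r C suc j) + + 1 * + (r C j)
  ≡⟨ cong₂ _+_ (ℤP.*-identityˡ (+ (r C suc j))) (ℤP.*-identityˡ (+ (r C j))) ⟩
    + (r C suc j) + + (r C j)
  ≡⟨ ℤP.+-comm (+ (r C suc j)) (+ (r C j)) ⟩
    + (r C j) + + (r C suc j)
  ≡⟨ pascal r j ⟩
    + (suc r C suc j) ∎
  where open ≡-Reasoning

-- Coefficient k+1 of (1-x) a is a_{k+1} - a_k; if a_{k+1} = z + a_k (a Pascal recurrence) it equals z.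
difference : ∀ x y z → z + y ≡ x → + 1 * x + - + 1 * y ≡ z
difference x y z z+y≡x rewrite sym z+y≡x = cancel z y
  where cancel : ∀ z y → + 1 * (z + y) + - + 1 * y ≡ z
        cancel = solve-∀

column : ℕ → Series
column s m = + (m C s)

column-step : ∀ s → oneMinusX ⊛ column (suc s) ≈ mono 1 ⊛ column s
column-step s zero    = trans (OneMinusX.at-zero (column (suc s))) (sym (x⊛-zero (column s)))
column-step s (suc k) = trans (OneMinusX.at-suc (column (suc s)) k)
  (trans (difference (column (suc s) (suc k)) (column (suc s) k) (column s k) (pascal k s))
         (sym (x⊛-suc (column s) k)))

x⊛mono : ∀ s → mono 1 ⊛ mono s ≈ mono (suc s)
x⊛mono s zero    = x⊛-zero (mono s)
x⊛mono s (suc k) = x⊛-suc (mono s) k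

column-gf : ∀ s → pow oneMinusX (suc s) ⊛ column s ≈ mono s
column-gf zero k = trans (⊛-congˡ (column 0) (one-⊛ oneMinusX) k) (first-column k)
  where first-column : oneMinusX ⊛ column 0 ≈ mono 0
        first-column zero    = refl
        first-column (suc k) = OneMinusX.at-suc (column 0) k
column-gf (suc s) k = begin
    ((P ⊛ oneMinusX) ⊛ column (suc s)) k
  ≡⟨ ⊛-assoc P oneMinusX (column (suc s)) k ⟩
    (P ⊛ (oneMinusX ⊛ column (suc s))) k
  ≡⟨ ⊛-congʳ P (column-step s) k ⟩
    (P ⊛ (mono 1 ⊛ column s)) k
  ≡⟨ sym (⊛-assoc P (mono 1) (column s) k) ⟩
    ((P ⊛ mono 1) ⊛ column s) k
  ≡⟨ ⊛-congˡ (column s) (⊛-comm P (mono 1)) k ⟩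
    ((mono 1 ⊛ P) ⊛ column s) k
  ≡⟨ ⊛-assoc (mono 1) P (column s) k ⟩
    (mono 1 ⊛ (P ⊛ column s)) k
  ≡⟨ ⊛-congʳ (mono 1) (column-gf s) k ⟩
    (mono 1 ⊛ mono s) k
  ≡⟨ x⊛mono s k ⟩
    mono (suc s) k ∎
  where open ≡-Reasoning
        P : Series
        P = pow oneMinusX (suc s)

shiftedColumn : ℕ → ℕ → Series
shiftedColumn a s m = + ((m ℕ.+ a) C (a ℕ.+ s))

-- The constant term: C(a+1, a+s+1) = C(a, a+s) (both are 1 for s = 0 and 0 otherwise).
top-binomial : ∀ a s → suc a C suc (a ℕ.+ s) ≡ a C (a ℕ.+ s)
top-binomial a zero rewrite ℕP.+-identityʳ a = trans (nCn≡1 (suc a)) (sym (nCn≡1 a))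
top-binomial a (suc s) =
  trans (k>n⇒nCk≡0 (s≤s (ℕP.m<m+n a (s≤s z≤n)))) (sym (k>n⇒nCk≡0 (ℕP.m<m+n a (s≤s z≤n))))

shiftedColumn-step : ∀ a s → oneMinusX ⊛ shiftedColumn (suc a) s ≈ shiftedColumn a s
shiftedColumn-step a s zero =
  trans (OneMinusX.at-zero (shiftedColumn (suc a) s)) (trans (ℤP.*-identityˡ _) (cong +_ (top-binomial a s)))
shiftedColumn-step a s (suc k) = trans (OneMinusX.at-suc (shiftedColumn (suc a) s) k) (difference _ _ _ recurrence)
  where recurrence : shiftedColumn a s (suc k) + shiftedColumn (suc a) s k ≡ shiftedColumn (suc a) s (suc k)
        recurrence rewrite ℕP.+-suc k a = pascal (suc (k ℕ.+ a)) (a ℕ.+ s)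

shiftedColumn-gf : ∀ a s → pow oneMinusX (suc (a ℕ.+ s)) ⊛ shiftedColumn a s ≈ mono s
shiftedColumn-gf zero s k =
  trans (⊛-congʳ (pow oneMinusX (suc s)) (λ m → cong (λ d → + (d C s)) (ℕP.+-identityʳ m)) k) (column-gf s k)
shiftedColumn-gf (suc a) s k = begin
    ((P ⊛ oneMinusX) ⊛ shiftedColumn (suc a) s) k
  ≡⟨ ⊛-assoc P oneMinusX (shiftedColumn (suc a) s) k ⟩
    (P ⊛ (oneMinusX ⊛ shiftedColumn (suc a) s)) k
  ≡⟨ ⊛-congʳ P (shiftedColumn-step a s) k ⟩
    (P ⊛ shiftedColumn a s) k
  ≡⟨ shiftedColumn-gf a s k ⟩
    mono s k ∎
  where open ≡-Reasoning
        P : Series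
        P = pow oneMinusX (suc (a ℕ.+ s))

Vinv-expansion : ∀ n q → q ≤ n → Vinv n q ≈ pow oneMinusX (suc (2 ℕ.* n)) ⊛ shiftedColumn n q
Vinv-expansion n q q≤n k = sym (begin
    (pow oneMinusX (suc (2 ℕ.* n)) ⊛ shiftedColumn n q) k
  ≡⟨ cong (λ e → (pow oneMinusX e ⊛ shiftedColumn n q) k) exponent ⟩
    (pow oneMinusX ((n ∸ q) ℕ.+ suc (n ℕ.+ q)) ⊛ shiftedColumn n q) k
  ≡⟨ ⊛-congˡ (shiftedColumn n q) (pow-+ oneMinusX (n ∸ q) (suc (n ℕ.+ q))) k ⟩
    ((pow oneMinusX (n ∸ q) ⊛ pow oneMinusX (suc (n ℕ.+ q))) ⊛ shiftedColumn n q) k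
  ≡⟨ ⊛-assoc (pow oneMinusX (n ∸ q)) (pow oneMinusX (suc (n ℕ.+ q))) (shiftedColumn n q) k ⟩
    (pow oneMinusX (n ∸ q) ⊛ (pow oneMinusX (suc (n ℕ.+ q)) ⊛ shiftedColumn n q)) k
  ≡⟨ ⊛-congʳ (pow oneMinusX (n ∸ q)) (shiftedColumn-gf n q) k ⟩
    Vinv n q k ∎)
  where
    open ≡-Reasoning
    exponent : suc (2 ℕ.* n) ≡ (n ∸ q) ℕ.+ suc (n ℕ.+ q)
    exponent = begin
        suc (n ℕ.+ (n ℕ.+ 0))
      ≡⟨ cong (λ d → suc (n ℕ.+ d)) (ℕP.+-identityʳ n) ⟩
        suc (n ℕ.+ n)
      ≡⟨ cong (λ d → suc (d ℕ.+ n)) (sym (ℕP.m∸n+n≡m q≤n)) ⟩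
        suc ((n ∸ q) ℕ.+ q ℕ.+ n)
      ≡⟨ cong suc (ℕP.+-assoc (n ∸ q) q n) ⟩
        suc ((n ∸ q) ℕ.+ (q ℕ.+ n))
      ≡⟨ cong (λ d → suc ((n ∸ q) ℕ.+ d)) (ℕP.+-comm q n) ⟩
        suc ((n ∸ q) ℕ.+ (n ℕ.+ q))
      ≡⟨ sym (ℕP.+-suc (n ∸ q) (n ℕ.+ q)) ⟩
        (n ∸ q) ℕ.+ suc (n ℕ.+ q) ∎

-- Evaluation of polynomials at natural numbers.

ev : ℕ → Series → ℕ → ℤ
ev N a m = sumUpTo N (λ q → a q * + (m ℕ.^ q))

DegreeAtMost : Series → ℕ → Set
DegreeAtMost a d = ∀ k → d < k → a k ≡ + 0

ev-cong : ∀ N {a b} m → a ≈ b → ev N a m ≡ ev N b m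
ev-cong N m a≈b = sum-ext N (λ q → cong (_* + (m ℕ.^ q)) (a≈b q))

degree-cong : ∀ {a b} d → a ≈ b → DegreeAtMost a d → DegreeAtMost b d
degree-cong d a≈b deg k d<k = trans (sym (a≈b k)) (deg k d<k)

ev-suc : ∀ a d m → DegreeAtMost a d → ev (suc d) a m ≡ ev d a m
ev-suc a d m deg rewrite deg (suc d) ℕP.≤-refl = ℤP.+-identityʳ (ev d a m)

ev-linear : ∀ N (s : ℤ) f g m → ev N (λ i → s * f i + g i) m ≡ s * ev N f m + ev N g m
ev-linear N s f g m = begin
    sumUpTo N (λ q → (s * f q + g q) * power q)
  ≡⟨ sum-ext N (λ q → affine-distrib s (f q) (g q) (power q)) ⟩
    sumUpTo N (λ q → s * (f q * power q) + g q * power q)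
  ≡⟨ sum-+ N _ _ ⟩
    sumUpTo N (λ q → s * (f q * power q)) + ev N g m
  ≡⟨ cong (_+ ev N g m) (sym (sum-*ˡ N s _)) ⟩
    s * ev N f m + ev N g m ∎
  where open ≡-Reasoning
        power : ℕ → ℤ
        power q = + (m ℕ.^ q)

ev-x⊛ : ∀ N a m → ev (suc N) (mono 1 ⊛ a) m ≡ + m * ev N a m
ev-x⊛ N a m = begin
    ev (suc N) (mono 1 ⊛ a) m
  ≡⟨ sum-peel N (λ q → (mono 1 ⊛ a) q * + (m ℕ.^ q)) ⟩
    (mono 1 ⊛ a) 0 * + 1 + sumUpTo N (λ q → (mono 1 ⊛ a) (suc q) * + (m ℕ.^ suc q))
  ≡⟨ cong₂ _+_ (cong (_* + 1) (x⊛-zero a)) (sum-ext N raised) ⟩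
    + 0 + sumUpTo N (λ q → + m * (a q * + (m ℕ.^ q)))
  ≡⟨ ℤP.+-identityˡ _ ⟩
    sumUpTo N (λ q → + m * (a q * + (m ℕ.^ q)))
  ≡⟨ sym (sum-*ˡ N (+ m) _) ⟩
    + m * ev N a m ∎
  where
    open ≡-Reasoning
    raised : ∀ q → (mono 1 ⊛ a) (suc q) * + (m ℕ.^ suc q) ≡ + m * (a q * + (m ℕ.^ q))
    raised q = begin
        (mono 1 ⊛ a) (suc q) * + (m ℕ.* m ℕ.^ q)
      ≡⟨ cong₂ _*_ (x⊛-suc a q) (ℤP.pos-* m (m ℕ.^ q)) ⟩
        a q * (+ m * + (m ℕ.^ q))
      ≡⟨ exchange (a q) (+ m) (+ (m ℕ.^ q)) ⟩
        + m * (a q * + (m ℕ.^ q)) ∎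
      where exchange : ∀ x y z → x * (y * z) ≡ y * (x * z)
            exchange = solve-∀

ev-⊛-linear : ∀ a d c m → DegreeAtMost a d → ev (suc d) (a ⊛ constPlusX c) m ≡ ev d a m * (+ m + c)
ev-⊛-linear a d c m deg = begin
    ev (suc d) (a ⊛ constPlusX c) m
  ≡⟨ ev-cong (suc d) m (λ k → trans (⊛-comm a (constPlusX c) k) (⊛-linearˡ c one (mono 1) a k)) ⟩
    ev (suc d) (λ k → c * (one ⊛ a) k + (mono 1 ⊛ a) k) m
  ≡⟨ ev-linear (suc d) c (one ⊛ a) (mono 1 ⊛ a) m ⟩
    c * ev (suc d) (one ⊛ a) m + ev (suc d) (mono 1 ⊛ a) m
  ≡⟨ cong₂ (λ u v → c * u + v) (trans (ev-cong (suc d) m (one-⊛ a)) (ev-suc a d m deg)) (ev-x⊛ d a m) ⟩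
    c * ev d a m + + m * ev d a m
  ≡⟨ factor c (ev d a m) (+ m) ⟩
    ev d a m * (+ m + c) ∎
  where open ≡-Reasoning
        factor : ∀ c e m → c * e + m * e ≡ e * (m + c)
        factor = solve-∀

degree-⊛-linear : ∀ a d c → DegreeAtMost a d → DegreeAtMost (a ⊛ constPlusX c) (suc d)
degree-⊛-linear a d c deg (suc k) (s≤s d<k) = begin
    (a ⊛ constPlusX c) (suc k)
  ≡⟨ ⊛-comm a (constPlusX c) (suc k) ⟩
    (constPlusX c ⊛ a) (suc k)
  ≡⟨ CPlusX.at-suc c a k ⟩
    c * a (suc k) + + 1 * a k
  ≡⟨ cong₂ (λ u v → c * u + + 1 * v) (deg (suc k) (ℕP.m<n⇒m<1+n d<k)) (deg k d<k) ⟩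
    c * + 0 + + 1 * + 0
  ≡⟨ cong (_+ + 0) (ℤP.*-zeroʳ c) ⟩
    + 0 ∎
  where open ≡-Reasoning

degree-falling : ∀ p → DegreeAtMost (falling p) p
degree-falling zero    (suc k) _ = refl
degree-falling (suc p) = degree-⊛-linear (falling p) p (- (+ p)) (degree-falling p)

ev-falling : ∀ p m → ev p (falling p) m ≡ + fall m p
ev-falling zero    m = refl
ev-falling (suc p) m = begin
    ev (suc p) (falling p ⊛ constPlusX (- + p)) m
  ≡⟨ ev-⊛-linear (falling p) p (- (+ p)) m (degree-falling p) ⟩
    ev p (falling p) m * (+ m + - + p)
  ≡⟨ cong (_* (+ m + - + p)) (ev-falling p m) ⟩
    + fall m p * (+ m + - + p)
  ≡⟨ last-factor (p ℕ.≤? m) ⟩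
    + fall m p * + (m ∸ p)
  ≡⟨ sym (ℤP.pos-* (fall m p) (m ∸ p)) ⟩
    + fall m (suc p) ∎
  where
    open ≡-Reasoning
    -- m - p is the truncated difference m ∸ p unless p > m, and then (m)_p = 0.
    last-factor : Dec (p ≤ m) → + fall m p * (+ m + - + p) ≡ + fall m p * + (m ∸ p)
    last-factor (yes p≤m) = cong (+ fall m p *_) (trans (ℤP.m-n≡m⊖n m p) (ℤP.⊖-≥ p≤m))
    last-factor (no p≰m) rewrite fall-vanishes m p (ℕP.≰⇒> p≰m) =
      trans (ℤP.*-zeroˡ (+ m + - + p)) (sym (ℤP.*-zeroˡ (+ (m ∸ p))))

degree-⊛rising : ∀ a d → DegreeAtMost a d → ∀ j → DegreeAtMost (a ⊛ rising1 j) (d ℕ.+ j)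
degree-⊛rising a d deg zero rewrite ℕP.+-identityʳ d = degree-cong d (λ k → sym (⊛-one a k)) deg
degree-⊛rising a d deg (suc j) rewrite ℕP.+-suc d j =
  degree-cong (suc (d ℕ.+ j)) (⊛-assoc a (rising1 j) (constPlusX (+ suc j)))
    (degree-⊛-linear (a ⊛ rising1 j) (d ℕ.+ j) (+ suc j) (degree-⊛rising a d deg j))

ev-⊛rising : ∀ a d m → DegreeAtMost a d → ∀ j → ev (d ℕ.+ j) (a ⊛ rising1 j) m ≡ ev d a m * + fall (m ℕ.+ j) j
ev-⊛rising a d m deg zero rewrite ℕP.+-identityʳ d = trans (ev-cong d m (⊛-one a)) (sym (ℤP.*-identityʳ _))
ev-⊛rising a d m deg (suc j) rewrite ℕP.+-suc d j = begin
    ev (suc (d ℕ.+ j)) (a ⊛ (rising1 j ⊛ constPlusX (+ suc j))) m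
  ≡⟨ ev-cong (suc (d ℕ.+ j)) m (λ k → sym (⊛-assoc a (rising1 j) (constPlusX (+ suc j)) k)) ⟩
    ev (suc (d ℕ.+ j)) ((a ⊛ rising1 j) ⊛ constPlusX (+ suc j)) m
  ≡⟨ ev-⊛-linear (a ⊛ rising1 j) (d ℕ.+ j) (+ suc j) m (degree-⊛rising a d deg j) ⟩
    ev (d ℕ.+ j) (a ⊛ rising1 j) m * (+ m + + suc j)
  ≡⟨ cong (_* (+ m + + suc j)) (ev-⊛rising a d m deg j) ⟩
    ev d a m * + fall (m ℕ.+ j) j * (+ m + + suc j)
  ≡⟨ ℤP.*-assoc (ev d a m) _ _ ⟩
    ev d a m * (+ fall (m ℕ.+ j) j * (+ m + + suc j))
  ≡⟨ cong (λ z → ev d a m * (+ fall (m ℕ.+ j) j * z)) (sym (ℤP.pos-+ m (suc j))) ⟩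
    ev d a m * (+ fall (m ℕ.+ j) j * + (m ℕ.+ suc j))
  ≡⟨ cong (ev d a m *_) (sym (ℤP.pos-* (fall (m ℕ.+ j) j) (m ℕ.+ suc j))) ⟩
    ev d a m * + (fall (m ℕ.+ j) j ℕ.* (m ℕ.+ suc j))
  ≡⟨ cong (λ z → ev d a m * + z) (sym (fall-rising m j)) ⟩
    ev d a m * + fall (m ℕ.+ suc j) (suc j) ∎
  where open ≡-Reasoning

ev-Uinv : ∀ p r m → ev (p ℕ.+ r) (Uinv (p ℕ.+ r) p) m ≡ + fall m p * + fall (m ℕ.+ r) r
ev-Uinv p r m = begin
    ev (p ℕ.+ r) (falling p ⊛ rising1 (p ℕ.+ r ∸ p)) m
  ≡⟨ cong (λ j → ev (p ℕ.+ r) (falling p ⊛ rising1 j) m) (ℕP.m+n∸m≡n p r) ⟩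
    ev (p ℕ.+ r) (falling p ⊛ rising1 r) m
  ≡⟨ ev-⊛rising (falling p) p m (degree-falling p) r ⟩
    ev p (falling p) m * + fall (m ℕ.+ r) r
  ≡⟨ cong (_* + fall (m ℕ.+ r) r) (ev-falling p m) ⟩
    + fall m p * + fall (m ℕ.+ r) r ∎
  where open ≡-Reasoning

-- Vandermonde's convolution.

vandermonde : ∀ m r p → sumUpTo r (λ j → + (r C j) * + (m C (p ℕ.+ j))) ≡ + ((m ℕ.+ r) C (p ℕ.+ r))
vandermonde m zero    p rewrite ℕP.+-identityʳ m | ℕP.+-identityʳ p = ℤP.*-identityˡ _
vandermonde m (suc r) p = begin
    sumUpTo (suc r) (λ j → + (suc r C j) * g j)
  ≡⟨ sum-peel r _ ⟩
    g₀ + sumUpTo r (λ j → + (suc r C suc j) * g (suc j))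
  ≡⟨ cong (_+_ g₀) (sum-ext r split) ⟩
    g₀ + sumUpTo r (λ j → + (r C j) * g (suc j) + + (r C suc j) * g (suc j))
  ≡⟨ cong (_+_ g₀) (sum-+ r _ _) ⟩
    g₀ + (A + B)
  ≡⟨ regroup g₀ A B ⟩
    A + (g₀ + B)
  ≡⟨ cong₂ _+_ shifted unshifted ⟩
    + ((m ℕ.+ r) C suc (p ℕ.+ r)) + + ((m ℕ.+ r) C (p ℕ.+ r))
  ≡⟨ ℤP.+-comm (+ ((m ℕ.+ r) C suc (p ℕ.+ r))) (+ ((m ℕ.+ r) C (p ℕ.+ r))) ⟩
    + ((m ℕ.+ r) C (p ℕ.+ r)) + + ((m ℕ.+ r) C suc (p ℕ.+ r))
  ≡⟨ pascal (m ℕ.+ r) (p ℕ.+ r) ⟩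
    + (suc (m ℕ.+ r) C suc (p ℕ.+ r))
  ≡⟨ cong₂ (λ x y → + (x C y)) (sym (ℕP.+-suc m r)) (sym (ℕP.+-suc p r)) ⟩
    + ((m ℕ.+ suc r) C (p ℕ.+ suc r)) ∎
  where
    open ≡-Reasoning
    g : ℕ → ℤ
    g j = + (m C (p ℕ.+ j))
    g₀ A B : ℤ
    g₀ = + 1 * g 0
    A = sumUpTo r (λ j → + (r C j) * g (suc j))
    B = sumUpTo r (λ j → + (r C suc j) * g (suc j))
    split : ∀ j → + (suc r C suc j) * g (suc j) ≡ + (r C j) * g (suc j) + + (r C suc j) * g (suc j)
    split j = trans (cong (_* g (suc j)) (sym (pascal r j))) (ℤP.*-distribʳ-+ (g (suc j)) (+ (r C j)) (+ (r C suc j)))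
    regroup : ∀ x a b → x + (a + b) ≡ a + (x + b)
    regroup = solve-∀
    -- A is the convolution for p + 1.
    shifted : A ≡ + ((m ℕ.+ r) C suc (p ℕ.+ r))
    shifted = trans (sum-ext r (λ j → cong (λ i → + (r C j) * + (m C i)) (ℕP.+-suc p j))) (vandermonde m r (suc p))
    -- g₀ + B is the convolution for p, extended by the vanishing term j = r + 1.
    unshifted : g₀ + B ≡ + ((m ℕ.+ r) C (p ℕ.+ r))
    unshifted = begin
        g₀ + B
      ≡⟨ sym (sum-peel r (λ j → + (r C j) * g j)) ⟩
        sumUpTo r (λ j → + (r C j) * g j) + + (r C suc r) * g (suc r)
      ≡⟨ cong (λ c → sumUpTo r (λ j → + (r C j) * g j) + + c * g (suc r)) (k>n⇒nCk≡0 (ℕP.n<1+n r)) ⟩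
        sumUpTo r (λ j → + (r C j) * g j) + + 0
      ≡⟨ ℤP.+-identityʳ _ ⟩
        sumUpTo r (λ j → + (r C j) * g j)
      ≡⟨ vandermonde m r p ⟩
        + ((m ℕ.+ r) C (p ℕ.+ r)) ∎

V-binomial-sum : ∀ m p r → sumUpTo (p ℕ.+ r) (λ q → Vop (p ℕ.+ r) p q * + (m C q)) ≡ + ((m ℕ.+ r) C (p ℕ.+ r))
V-binomial-sum m p r = begin
    sumUpTo (p ℕ.+ r) (λ q → (pow onePlusX (p ℕ.+ r ∸ p) ⊛ mono p) q * + (m C q))
  ≡⟨ sum-ext (p ℕ.+ r) (λ q → cong (λ e → (pow onePlusX e ⊛ mono p) q * + (m C q)) (ℕP.m+n∸m≡n p r)) ⟩
    sumUpTo (p ℕ.+ r) (λ q → (pow onePlusX r ⊛ mono p) q * + (m C q))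
  ≡⟨ sum-shift p r _ (λ q q<p → cong (_* + (m C q)) (⊛-mono-< (pow onePlusX r) p q q<p)) ⟩
    sumUpTo r (λ j → (pow onePlusX r ⊛ mono p) (p ℕ.+ j) * + (m C (p ℕ.+ j)))
  ≡⟨ sum-ext r (λ j → cong (_* + (m C (p ℕ.+ j))) (coefficient j)) ⟩
    sumUpTo r (λ j → + (r C j) * + (m C (p ℕ.+ j)))
  ≡⟨ vandermonde m r p ⟩
    + ((m ℕ.+ r) C (p ℕ.+ r)) ∎
  where
    open ≡-Reasoning
    coefficient : ∀ j → (pow onePlusX r ⊛ mono p) (p ℕ.+ j) ≡ + (r C j)
    coefficient j = trans (⊛-mono-≥ (pow onePlusX r) p (p ℕ.+ j) (ℕP.m≤m+n p j))
      (trans (cong (pow onePlusX r) (ℕP.m+n∸m≡n p j)) (binomial-theorem r j))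

-- Linear operators given on monomials.

applyOn-cong : ∀ N {L L′ : ℕ → Series} f → (∀ q → q ≤ N → L q ≈ L′ q) → applyOn N L f ≈ applyOn N L′ f
applyOn-cong N f L≈L′ k = sum-cong N (λ q q≤N → cong (f q *_) (L≈L′ q q≤N k))

applyOn-⊛ : ∀ N P (B : ℕ → Series) f → applyOn N (λ q → P ⊛ B q) f ≈ P ⊛ applyOn N B f
applyOn-⊛ N P B f k = begin
    sumUpTo N (λ q → f q * sumUpTo k (λ i → P i * B q (k ∸ i)))
  ≡⟨ sum-ext N (λ q → sum-*ˡ k (f q) _) ⟩
    sumUpTo N (λ q → sumUpTo k (λ i → f q * (P i * B q (k ∸ i))))
  ≡⟨ sym (sum-swap k N _) ⟩
    sumUpTo k (λ i → sumUpTo N (λ q → f q * (P i * B q (k ∸ i))))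
  ≡⟨ sum-ext k (λ i → trans (sum-ext N (λ q → exchange (f q) (P i) (B q (k ∸ i)))) (sym (sum-*ˡ N (P i) _))) ⟩
    sumUpTo k (λ i → P i * sumUpTo N (λ q → f q * B q (k ∸ i))) ∎
  where open ≡-Reasoning
        exchange : ∀ x y z → x * (y * z) ≡ y * (x * z)
        exchange = solve-∀

applyOn-diagonal : ∀ N (c : ℕ → ℤ) f q → q ≤ N → applyOn N (λ q′ → scale (c q′) (mono q′)) f q ≡ f q * c q
applyOn-diagonal N c f q q≤N = trans
  (sum-ext N (λ q′ → trans (cong (λ δ → f q′ * (c q′ * δ)) (mono-sym q′ q)) (rotate (f q′) (c q′) (mono q q′))))
  (sift-≤ N q (λ q′ → f q′ * c q′) q≤N)
  where rotate : ∀ a b d → a * (b * d) ≡ d * (a * b)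
        rotate = solve-∀

-- F_n x^q = (1-x)^{2n+1} · Σ_m m^q C(m+n,n) x^m.
weightedPowers : ℕ → ℕ → Series
weightedPowers n q m = + (m ℕ.^ q ℕ.* ((m ℕ.+ n) C n))

-- The identity for n = p + r.  Both sides are (1-x)^{2n+1} times the series with coefficients
-- c(m) = C(m+r,n) (m+n)_n.
module SplitDegree (p r : ℕ) where

  n : ℕ
  n = p ℕ.+ r

  c : ℕ → ℤ
  c m = + (((m ℕ.+ r) C n) ℕ.* fall (m ℕ.+ n) n)

  eigenvalue : ℕ → ℤ
  eigenvalue q = + (((n ℕ.+ q) ! / q !) {{q !≢0}})

  left-coefficients : applyOn n (weightedPowers n) (Uinv n p) ≈ c
  left-coefficients m = begin
      sumUpTo n (λ q → Uinv n p q * + (m ℕ.^ q ℕ.* b))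
    ≡⟨ sum-ext n (λ q → trans (cong (Uinv n p q *_) (ℤP.pos-* (m ℕ.^ q) b)) (sym (ℤP.*-assoc (Uinv n p q) (+ (m ℕ.^ q)) (+ b)))) ⟩
      sumUpTo n (λ q → Uinv n p q * + (m ℕ.^ q) * + b)
    ≡⟨ sym (sum-*ʳ n (+ b) _) ⟩
      ev n (Uinv n p) m * + b
    ≡⟨ cong (_* + b) (ev-Uinv p r m) ⟩
      + fall m p * + fall (m ℕ.+ r) r * + b
    ≡⟨ cong (_* + b) (sym (ℤP.pos-* (fall m p) (fall (m ℕ.+ r) r))) ⟩
      + (fall m p ℕ.* fall (m ℕ.+ r) r) * + b
    ≡⟨ sym (ℤP.pos-* (fall m p ℕ.* fall (m ℕ.+ r) r) b) ⟩
      + (fall m p ℕ.* fall (m ℕ.+ r) r ℕ.* b)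
    ≡⟨ cong +_ (value-agreement m p r) ⟩
      c m ∎
    where open ≡-Reasoning
          b : ℕ
          b = (m ℕ.+ n) C n

  right-coefficients : applyOn n (shiftedColumn n) (applyOn n (Cop n) (Vop n p)) ≈ c
  right-coefficients m = begin
      sumUpTo n (λ q → applyOn n (Cop n) (Vop n p) q * shiftedColumn n q m)
    ≡⟨ sum-cong n (λ q q≤n → cong (_* shiftedColumn n q m) (applyOn-diagonal n eigenvalue (Vop n p) q q≤n)) ⟩
      sumUpTo n (λ q → Vop n p q * eigenvalue q * shiftedColumn n q m)
    ≡⟨ sum-ext n exchange ⟩
      sumUpTo n (λ q → Vop n p q * + (m C q) * + F)
    ≡⟨ sym (sum-*ʳ n (+ F) _) ⟩
      sumUpTo n (λ q → Vop n p q * + (m C q)) * + F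
    ≡⟨ cong (_* + F) (V-binomial-sum m p r) ⟩
      + ((m ℕ.+ r) C n) * + F
    ≡⟨ sym (ℤP.pos-* ((m ℕ.+ r) C n) F) ⟩
      c m ∎
    where
      open ≡-Reasoning
      F : ℕ
      F = fall (m ℕ.+ n) n
      exchange : ∀ q → Vop n p q * eigenvalue q * shiftedColumn n q m ≡ Vop n p q * + (m C q) * + F
      exchange q = begin
          Vop n p q * eigenvalue q * shiftedColumn n q m
        ≡⟨ ℤP.*-assoc (Vop n p q) _ _ ⟩
          Vop n p q * (eigenvalue q * shiftedColumn n q m)
        ≡⟨ cong (Vop n p q *_) (sym (ℤP.pos-* (((n ℕ.+ q) ! / q !) {{q !≢0}}) ((m ℕ.+ n) C (n ℕ.+ q)))) ⟩
          Vop n p q * + ((((n ℕ.+ q) ! / q !) {{q !≢0}}) ℕ.* ((m ℕ.+ n) C (n ℕ.+ q)))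
        ≡⟨ cong (λ e → Vop n p q * + (e ℕ.* ((m ℕ.+ n) C (n ℕ.+ q)))) (factorial-ratio n q) ⟩
          Vop n p q * + (fall (n ℕ.+ q) n ℕ.* ((m ℕ.+ n) C (n ℕ.+ q)))
        ≡⟨ cong (λ e → Vop n p q * + e) (fall-binomial-exchange m n q) ⟩
          Vop n p q * + ((m C q) ℕ.* F)
        ≡⟨ cong (Vop n p q *_) (ℤP.pos-* (m C q) F) ⟩
          Vop n p q * (+ (m C q) * + F)
        ≡⟨ sym (ℤP.*-assoc (Vop n p q) _ _) ⟩
          Vop n p q * + (m C q) * + F ∎

  identity : ∀ k → applyOn n (Fop n) (Uinv n p) k ≡ applyOn n (Vinv n) (applyOn n (Cop n) (Vop n p)) k
  identity k = begin
      applyOn n (λ q → P ⊛ weightedPowers n q) (Uinv n p) k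
    ≡⟨ applyOn-⊛ n P (weightedPowers n) (Uinv n p) k ⟩
      (P ⊛ applyOn n (weightedPowers n) (Uinv n p)) k
    ≡⟨ ⊛-congʳ P (λ m → trans (left-coefficients m) (sym (right-coefficients m))) k ⟩
      (P ⊛ applyOn n (shiftedColumn n) w) k
    ≡⟨ sym (applyOn-⊛ n P (shiftedColumn n) w k) ⟩
      applyOn n (λ q → P ⊛ shiftedColumn n q) w k
    ≡⟨ applyOn-cong n w (λ q q≤n j → sym (Vinv-expansion n q q≤n j)) k ⟩
      applyOn n (Vinv n) w k ∎
    where open ≡-Reasoning
          P : Series
          P = pow oneMinusX (suc (2 ℕ.* n))
          w : Series
          w = applyOn n (Cop n) (Vop n p)

theorem12 : (n p : ℕ) → p ≤ n → (k : ℕ) →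
    applyOn n (Fop n) (Uinv n p) k ≡ applyOn n (Vinv n) (applyOn n (Cop n) (Vop n p)) k
theorem12 n p p≤n k =
  subst (λ N → applyOn N (Fop N) (Uinv N p) k ≡ applyOn N (Vinv N) (applyOn N (Cop N) (Vop N p)) k)
        (ℕP.m+[n∸m]≡n p≤n) (SplitDegree.identity p (n ∸ p) k)
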